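{- Let $\Gamma=(\Omega,E)$ be a strongly regular graph, $G=\mathrm{Aut}(\Gamma)$, and $\omega\in\Omega$ a vertex such that $T_{0,\omega}=T_\omega=\tilde T_\omega$. Let $\Delta_1$ be the set of neighbours of $\omega$ and $\Delta_2$ the set of vertices other than $\omega$ not adjacent to $\omega$. Then one of the following holds: (a) $G$ is transitive of rank $3$ on $\Omega$; (b) $G=G_\omega$, and $G$ is transitive on each of $\{\omega\}$, $\Delta_1$ and $\Delta_2$.
   Context: Let $A_0=I$, $A_1$ the adjacency matrix of $\Gamma$, $A_2=J-I-A_1$. For $i=0,1,2$, $E^*_{i,\omega}$ is the diagonal matrix whose diagonal is the $\omega$-row of $A_i$. $T_\omega$ is the subalgebra of $M_{|\Omega|}(\mathbb C)$ generated by $A_0,A_1,A_2,E^*_{0,\omega},E^*_{1,\omega},E^*_{2,\omega}$ (the Terwilliger algebra), $T_{0,\omega}$ is the linear span of $\{E^*_{i,\omega}A_jE^*_{k,\omega}:0\le i,j,k\le 2\}$, and $\tilde T_\omega$ is the algebra of all complex matrices commuting with the permutation matrices of all elements of the stabilizer $G_\omega$. A transitive permutation group has rank $3$ if a point stabilizer has exactly $3$ orbits. -}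

module Defs where

open import Data.Nat as ℕ using (ℕ; zero; suc; _∸_)
open import Data.Bool using (Bool; true; false; if_then_else_; not)
open import Data.Fin using (Fin; _≟_)
open import Data.Fin.Permutation using (Permutation′; _⟨$⟩ʳ_)
open import Data.Rational as ℚ using (ℚ; 0ℚ; 1ℚ)
open import Data.List using (List; []; _∷_; foldr; map)
open import Data.Product using (_×_; _,_; Σ; ∃; ∃-syntax)
open import Data.Sum using (_⊎_)
open import Relation.Nullary.Decidable using (⌊_⌋)
open import Relation.Binary.PropositionalEquality using (_≡_; _≢_)
open import Relation.Nullary using (¬_)

sumFin : ∀ {n} → (Fin n → ℚ) → ℚ
sumFin {zero}  f = 0ℚ
sumFin {suc n} f = f Fin.zero ℚ.+ sumFin (λ i → f (Fin.suc i))
  where import Data.Fin as Fin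

countFin : ∀ {n} → (Fin n → Bool) → ℕ
countFin {zero}  p = 0
countFin {suc n} p = (if p Fin.zero then 1 else 0) ℕ.+ countFin (λ i → p (Fin.suc i))
  where import Data.Fin as Fin

record Graph (n : ℕ) : Set where
  field
    adj   : Fin n → Fin n → Bool
    sym   : ∀ x y → adj x y ≡ adj y x
    irrefl : ∀ x → adj x x ≡ false

open Graph public

common : ∀ {n} → Graph n → Fin n → Fin n → ℕ
common Γ x y = countFin (λ z → if adj Γ x z then adj Γ y z else false)

-- Strongly regular graph with parameters (n , k , λ , μ), nontrivial
-- (neither complete nor edgeless): 0 < k < n - 1.
record IsSRG {n : ℕ} (Γ : Graph n) (k lam mu : ℕ) : Set where
  field
    nontrivial₁ : 0 ℕ.< k
    nontrivial₂ : k ℕ.< n ∸ 1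
    regular     : ∀ x → countFin (adj Γ x) ≡ k
    adjacent    : ∀ x y → adj Γ x y ≡ true → common Γ x y ≡ lam
    nonadjacent : ∀ x y → x ≢ y → adj Γ x y ≡ false → common Γ x y ≡ mu

IsStronglyRegular : ∀ {n} → Graph n → Set
IsStronglyRegular Γ = ∃[ k ] ∃[ lam ] ∃[ mu ] IsSRG Γ k lam mu

IsAut : ∀ {n} → Graph n → Permutation′ n → Set
IsAut Γ g = ∀ x y → adj Γ (g ⟨$⟩ʳ x) (g ⟨$⟩ʳ y) ≡ adj Γ x y

InStab : ∀ {n} → Graph n → Fin n → Permutation′ n → Set
InStab Γ ω g = IsAut Γ g × (g ⟨$⟩ʳ ω ≡ ω)

Mat : ℕ → Set
Mat n = Fin n → Fin n → ℚ

_≈ᴹ_ : ∀ {n} → Mat n → Mat n → Set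
M ≈ᴹ N = ∀ i j → M i j ≡ N i j

_*ᴹ_ : ∀ {n} → Mat n → Mat n → Mat n
(M *ᴹ N) i j = sumFin (λ l → M i l ℚ.* N l j)

_+ᴹ_ : ∀ {n} → Mat n → Mat n → Mat n
(M +ᴹ N) i j = M i j ℚ.+ N i j

_·ᴹ_ : ∀ {n} → ℚ → Mat n → Mat n
(c ·ᴹ M) i j = c ℚ.* M i j

zeroᴹ : ∀ {n} → Mat n
zeroᴹ i j = 0ℚ

b2q : Bool → ℚ
b2q b = if b then 1ℚ else 0ℚ

eqB : ∀ {n} → Fin n → Fin n → Bool
eqB i j = ⌊ i ≟ j ⌋

relA : ∀ {n} → Graph n → Fin 3 → Fin n → Fin n → Bool
relA Γ Fin.zero x y = eqB x y
  where import Data.Fin as Fin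
relA Γ (Fin.suc Fin.zero) x y = adj Γ x y
  where import Data.Fin as Fin
relA Γ (Fin.suc (Fin.suc Fin.zero)) x y = if eqB x y then false else not (adj Γ x y)
  where import Data.Fin as Fin

A : ∀ {n} → Graph n → Fin 3 → Mat n
A Γ i x y = b2q (relA Γ i x y)

Estar : ∀ {n} → Graph n → Fin n → Fin 3 → Mat n
Estar Γ ω i x y = if eqB x y then A Γ i ω x else 0ℚ

-- permutation matrix of g : P_g e_j = e_{g j}
permMat : ∀ {n} → Permutation′ n → Mat n
permMat g i j = b2q (eqB i (g ⟨$⟩ʳ j))

lincomb : ∀ {n} {I : Set} → (I → Mat n) → List (ℚ × I) → Mat n
lincomb f = foldr (λ { (c , t) acc → (c ·ᴹ f t) +ᴹ acc }) zeroᴹ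

InSpan : ∀ {n} {I : Set} → (I → Mat n) → Mat n → Set
InSpan {I = I} f M = Σ (List (ℚ × I)) λ cs → M ≈ᴹ lincomb f cs

-- generators of the Terwilliger algebra: A_i (inj₁) and E*_{i,ω} (inj₂)
Gen : Set
Gen = Fin 3 ⊎ Fin 3

gen : ∀ {n} → Graph n → Fin n → Gen → Mat n
gen Γ ω (Data.Sum.inj₁ i) = A Γ i
gen Γ ω (Data.Sum.inj₂ i) = Estar Γ ω i

idᴹ : ∀ {n} → Mat n
idᴹ i j = b2q (eqB i j)

wordMat : ∀ {n} → Graph n → Fin n → List Gen → Mat n
wordMat Γ ω = foldr (λ s acc → gen Γ ω s *ᴹ acc) idᴹ

-- T_ω : the subalgebra generated = span of all words in the generators
InT : ∀ {n} → Graph n → Fin n → Mat n → Set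
InT Γ ω = InSpan (wordMat Γ ω)

InT0 : ∀ {n} → Graph n → Fin n → Mat n → Set
InT0 Γ ω = InSpan {I = Fin 3 × Fin 3 × Fin 3}
  (λ { (i , j , k) → (Estar Γ ω i *ᴹ A Γ j) *ᴹ Estar Γ ω k })

InTtilde : ∀ {n} → Graph n → Fin n → Mat n → Set
InTtilde Γ ω M = ∀ g → InStab Γ ω g → (permMat g *ᴹ M) ≈ᴹ (M *ᴹ permMat g)

_≐_ : ∀ {n} → (Mat n → Set) → (Mat n → Set) → Set
P ≐ Q = ∀ M → (P M → Q M) × (Q M → P M)

SameOrbit : ∀ {n} → Graph n → (Permutation′ n → Set) → Fin n → Fin n → Set
SameOrbit Γ P x y = ∃[ g ] (IsAut Γ g × P g × (g ⟨$⟩ʳ x ≡ y))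

AutTransitive : ∀ {n} → Graph n → Set
AutTransitive Γ = ∀ x y → SameOrbit Γ (λ _ → ⊤) x y
  where open import Data.Unit using (⊤)

StabHas3Orbits : ∀ {n} → Graph n → Fin n → Set
StabHas3Orbits Γ α =
  ∃[ a ] ∃[ b ] ∃[ c ]
    ( ¬ SameOrbit Γ P a b × ¬ SameOrbit Γ P a c × ¬ SameOrbit Γ P b c
    × (∀ x → SameOrbit Γ P a x ⊎ SameOrbit Γ P b x ⊎ SameOrbit Γ P c x))
  where P = λ g → g ⟨$⟩ʳ α ≡ α

AutRank3 : ∀ {n} → Graph n → Set
AutRank3 Γ = AutTransitive Γ × ∃[ α ] StabHas3Orbits Γ α

-- The diagonal 0/1 matrix of a G_ω-orbit commutes with G_ω, so it lies in T̃_ω = T_ω = T_{0,ω};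
-- but the diagonal of every element of T_{0,ω} is constant on each of {ω}, Δ₁ and Δ₂.  Hence the
-- G_ω-orbits are exactly {ω}, Δ₁ and Δ₂, which gives (b) when G fixes ω.  Otherwise the G-orbit O
-- of ω contains Δ₁ or Δ₂, and, by conjugation, the stabiliser of any z ∈ O has the orbits {z},
-- Γ(z) and Ω ∖ ({z} ∪ Γ(z)).  Say O ⊇ Δ₁.  If some edge zy joins Δ₁ to Δ₂, then ω and y are both
-- neighbours of z ∈ O, so O meets Δ₂ as well.  If there is no such edge then μ = 0, Γ is a disjoint
-- union of cliques of size k + 1, and exchanging two of them moves ω into Δ₂.  The case O ⊇ Δ₂ is
-- dual: a non-edge from Δ₂ to Δ₁, or else μ = k and Γ is complete multipartite.  Either way G is
-- transitive, and with the three G_ω-orbits it has rank 3.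

{-# OPTIONS --safe #-}
module Submission where

open import Defs hiding (sym)
open import Data.Nat using (ℕ; zero; suc; _+_; _∸_; _≤_; _<_; z≤n; s≤s)
import Data.Nat.Properties as ℕ
open import Data.Bool using (Bool; true; false; if_then_else_; not; _∧_; _∨_; T)
import Data.Bool.Properties as Bool
open import Data.Fin using (Fin; _≟_)
import Data.Fin as F
import Data.Fin.Properties as F
open import Data.Fin.Permutation
  using (Permutation′; _⟨$⟩ʳ_; _⟨$⟩ˡ_; permutation; inverseˡ; inverseʳ; flip; _∘ₚ_)
import Data.Fin.Permutation as Perm
import Data.Fin.Permutation.Components as PC
open import Data.List using (List; []; _∷_; length; tabulate; filterᵇ; allFin)
open import Data.List.Membership.Propositional using (_∈_; _∉_)
open import Data.List.Membership.Propositional.Properties using (∈-filter⁺; ∈-filter⁻; ∈-allFin)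
open import Data.List.Relation.Unary.All.Properties using (All¬⇒¬Any)
open import Data.List.Relation.Unary.Any using (here; there)
open import Data.List.Relation.Unary.Unique.Propositional using (Unique; []; _∷_)
import Data.List.Relation.Unary.Unique.Propositional.Properties as Unique
open import Data.Product using (_×_; _,_; ∃; proj₂)
open import Data.Sum using (_⊎_; inj₁; inj₂)
import Data.Sum as Sum
open import Data.Rational using (ℚ; 0ℚ; 1ℚ)
import Data.Rational as ℚ
import Data.Rational.Properties as ℚ
open import Data.Unit using (⊤; tt)
import Data.Vec.Functional as Vector
open import Data.Empty using (⊥-elim)
open import Function using (_∘_; id; Injection; Equivalence; mk⇔)
open import Function.Properties.Inverse using (↔⇒↣)
open import Relation.Nullary using (¬_; Dec; yes; no; ¬?; _×-dec_)
open import Relation.Nullary.Decidable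
  using (does; map′; decidable-stable; isYes≗does; dec-true; dec-false; does-⇔; T?)
open import Relation.Unary using (Decidable)
open import Relation.Binary.Definitions using (_Respects_)
open import Relation.Binary.PropositionalEquality

private
  variable
    n : ℕ

true≢false : true ≢ false
true≢false ()

eqB-refl : (x : Fin n) → eqB x x ≡ true
eqB-refl x = trans (isYes≗does (x ≟ x)) (dec-true (x ≟ x) refl)

eqB-≢ : {x y : Fin n} → x ≢ y → eqB x y ≡ false
eqB-≢ {x = x} {y} x≢y = trans (isYes≗does (x ≟ y)) (dec-false (x ≟ y) x≢y)

eqB⇒≡ : {x y : Fin n} → eqB x y ≡ true → x ≡ y
eqB⇒≡ {x = x} {y} e with x ≟ y
... | yes x≡y = x≡y

eqB-suc : (x y : Fin n) → eqB (F.suc x) (F.suc y) ≡ eqB x y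
eqB-suc x y with x ≟ y
... | yes _ = refl
... | no _  = refl

eqB-⟨$⟩ʳ : (σ : Permutation′ n) (x y : Fin n) → eqB (σ ⟨$⟩ʳ x) (σ ⟨$⟩ʳ y) ≡ eqB x y
eqB-⟨$⟩ʳ σ x y with x ≟ y
... | yes refl = eqB-refl (σ ⟨$⟩ʳ x)
... | no x≢y  = eqB-≢ (x≢y ∘ Injection.injective (↔⇒↣ σ))

∨-≡-true : ∀ a {b} → a ∨ b ≡ true → a ≡ true ⊎ b ≡ true
∨-≡-true true  _ = inj₁ refl
∨-≡-true false e = inj₂ e

countFin-cong : {p q : Fin n → Bool} → (∀ v → p v ≡ q v) → countFin p ≡ countFin q
countFin-cong {n = zero}  p≗q = refl
countFin-cong {n = suc n} p≗q rewrite p≗q F.zero = cong (_ +_) (countFin-cong (p≗q ∘ F.suc))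

countFin-none : {p : Fin n → Bool} → (∀ v → p v ≡ false) → countFin p ≡ 0
countFin-none {n = zero}  _   = refl
countFin-none {n = suc n} p≗f rewrite p≗f F.zero = countFin-none (p≗f ∘ F.suc)

countFin-all : countFin {n} (λ _ → true) ≡ n
countFin-all {zero}  = refl
countFin-all {suc n} = cong suc countFin-all

countFin-pos : {p : Fin n → Bool} (v : Fin n) → p v ≡ true → 0 < countFin p
countFin-pos {p = p} F.zero    pv rewrite pv = s≤s z≤n
countFin-pos {p = p} (F.suc v) pv with p F.zero
... | true  = s≤s z≤n
... | false = countFin-pos v pv

countFin-witness : (p : Fin n → Bool) → 0 < countFin p → ∃ λ v → p v ≡ true
countFin-witness {n = suc n} p pos with p F.zero in p0
... | true  = F.zero , p0
... | false = let v , pv = countFin-witness (p ∘ F.suc) pos in F.suc v , pv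

_⊆ᵇ_ : (Fin n → Bool) → (Fin n → Bool) → Set
p ⊆ᵇ q = ∀ v → p v ≡ true → q v ≡ true

countFin-mono : {p q : Fin n → Bool} → p ⊆ᵇ q → countFin p ≤ countFin q
countFin-mono {n = zero}              p⊆q = z≤n
countFin-mono {n = suc n} {p} {q} p⊆q with p F.zero in p0 | q F.zero in q0
... | true  | true  = s≤s (countFin-mono (p⊆q ∘ F.suc))
... | true  | false = ⊥-elim (true≢false (trans (sym (p⊆q F.zero p0)) q0))
... | false | true  = ℕ.m≤n⇒m≤1+n (countFin-mono (p⊆q ∘ F.suc))
... | false | false = countFin-mono (p⊆q ∘ F.suc)

countFin-mono-< : {p q : Fin n → Bool} → p ⊆ᵇ q →
                  (v : Fin n) → q v ≡ true → p v ≡ false → countFin p < countFin q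
countFin-mono-< {p = p} {q} p⊆q F.zero qv pv rewrite qv | pv = s≤s (countFin-mono (p⊆q ∘ F.suc))
countFin-mono-< {p = p} {q} p⊆q (F.suc v) qv pv with p F.zero in p0 | q F.zero in q0
... | true  | true  = s≤s (countFin-mono-< (p⊆q ∘ F.suc) v qv pv)
... | true  | false = ⊥-elim (true≢false (trans (sym (p⊆q F.zero p0)) q0))
... | false | true  = ℕ.m<n⇒m<1+n (countFin-mono-< (p⊆q ∘ F.suc) v qv pv)
... | false | false = countFin-mono-< (p⊆q ∘ F.suc) v qv pv

countFin-⊆-≡ : {p q : Fin n → Bool} → p ⊆ᵇ q → countFin p ≡ countFin q → q ⊆ᵇ p
countFin-⊆-≡ {p = p} p⊆q #p≡#q v qv with p v in pv
... | true  = refl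
... | false = ⊥-elim (ℕ.<-irrefl #p≡#q (countFin-mono-< p⊆q v qv pv))

countFin-complement : (p : Fin n → Bool) → countFin p + countFin (not ∘ p) ≡ n
countFin-complement {zero}  p = refl
countFin-complement {suc n} p with p F.zero
... | true  = cong suc (countFin-complement (p ∘ F.suc))
... | false = trans (ℕ.+-suc _ _) (cong suc (countFin-complement (p ∘ F.suc)))

countFin-insert : (z : Fin n) (q : Fin n → Bool) → q z ≡ false →
                  countFin (λ v → eqB z v ∨ q v) ≡ suc (countFin q)
countFin-insert F.zero    q qz rewrite qz = refl
countFin-insert (F.suc z) q qz = begin
  (if q F.zero then 1 else 0) + countFin (λ v → eqB (F.suc z) (F.suc v) ∨ q (F.suc v))
    ≡⟨ cong (_ +_) (countFin-cong (λ v → cong (_∨ q (F.suc v)) (eqB-suc z v))) ⟩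
  (if q F.zero then 1 else 0) + countFin (λ v → eqB z v ∨ q (F.suc v))
    ≡⟨ cong (_ +_) (countFin-insert z (q ∘ F.suc) qz) ⟩
  (if q F.zero then 1 else 0) + suc (countFin (q ∘ F.suc))
    ≡⟨ ℕ.+-suc _ _ ⟩
  suc (countFin q) ∎
  where open ≡-Reasoning

enumerate : (Fin n → Bool) → List (Fin n)
enumerate p = filterᵇ p (allFin _)

∈-enumerate⁺ : {p : Fin n → Bool} {v : Fin n} → p v ≡ true → v ∈ enumerate p
∈-enumerate⁺ {p = p} {v} pv = ∈-filter⁺ (T? ∘ p) (∈-allFin v) (subst T (sym pv) tt)

∈-enumerate⁻ : {p : Fin n → Bool} {v : Fin n} → v ∈ enumerate p → p v ≡ true
∈-enumerate⁻ {n} {p = p} v∈ =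
  Equivalence.to Bool.T-≡ (proj₂ (∈-filter⁻ (T? ∘ p) {xs = allFin n} v∈))

enumerate-unique : (p : Fin n → Bool) → Unique (enumerate p)
enumerate-unique {n} p = Unique.filter⁺ (T? ∘ p) (Unique.allFin⁺ n)

length-filterᵇ-tabulate : ∀ {m} (p : Fin n → Bool) (f : Fin m → Fin n) →
                          length (filterᵇ p (tabulate f)) ≡ countFin (p ∘ f)
length-filterᵇ-tabulate {m = zero}  p f = refl
length-filterᵇ-tabulate {m = suc m} p f with p (f F.zero)
... | true  = cong suc (length-filterᵇ-tabulate p (f ∘ F.suc))
... | false = length-filterᵇ-tabulate p (f ∘ F.suc)

length-enumerate : (p : Fin n → Bool) → length (enumerate p) ≡ countFin p
length-enumerate p = length-filterᵇ-tabulate p id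

-- Exchanging two disjoint blocks of equal size

module _ {i j : Fin n} where

  transpose-at-i : PC.transpose i j i ≡ j
  transpose-at-i rewrite dec-true (i ≟ i) refl = refl

  transpose-at-j : PC.transpose i j j ≡ i
  transpose-at-j with j ≟ i
  ... | yes refl = refl
  ... | no _ rewrite dec-true (j ≟ j) refl = refl

  transpose-fix : {k : Fin n} → k ≢ i → k ≢ j → PC.transpose i j k ≡ k
  transpose-fix {k} k≢i k≢j rewrite dec-false (k ≟ i) k≢i | dec-false (k ≟ j) k≢j = refl

  private
    τ : Fin n → Fin n
    τ = PC.transpose i j

  transpose-involutive : (k : Fin n) → τ (τ k) ≡ k
  transpose-involutive k = by-cases (k ≟ i) (k ≟ j)
    where
    by-cases : Dec (k ≡ i) → Dec (k ≡ j) → τ (τ k) ≡ k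
    by-cases (yes refl) _        = trans (cong τ transpose-at-i) transpose-at-j
    by-cases (no _)     (yes refl) = trans (cong τ transpose-at-j) transpose-at-i
    by-cases (no k≢i)   (no k≢j)   = trans (cong τ (transpose-fix k≢i k≢j)) (transpose-fix k≢i k≢j)

  transpose-commute : (f : Fin n → Fin n) → f i ≡ i → f j ≡ j →
                      (∀ {x y} → f x ≡ f y → x ≡ y) → ∀ k → f (τ k) ≡ τ (f k)
  transpose-commute f fi fj f-inj k = by-cases (k ≟ i) (k ≟ j)
    where
    by-cases : Dec (k ≡ i) → Dec (k ≡ j) → f (τ k) ≡ τ (f k)
    by-cases (yes refl) _          =
      trans (cong f transpose-at-i) (trans fj (sym (trans (cong τ fi) transpose-at-i)))
    by-cases (no _)     (yes refl) =
      trans (cong f transpose-at-j) (trans fi (sym (trans (cong τ fj) transpose-at-j)))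
    by-cases (no k≢i)   (no k≢j)   = trans (cong f (transpose-fix k≢i k≢j))
      (sym (transpose-fix (λ fk≡i → k≢i (f-inj (trans fk≡i (sym fi))))
                          (λ fk≡j → k≢j (f-inj (trans fk≡j (sym fj))))))

swapPairs : List (Fin n) → List (Fin n) → Fin n → Fin n
swapPairs (a ∷ as) (b ∷ bs) v = PC.transpose a b (swapPairs as bs v)
swapPairs _        _        v = v

data Pairing {n} : List (Fin n) → List (Fin n) → Set where
  []  : Pairing [] []
  _∷_ : ∀ {a b as bs} → a ∉ b ∷ as × a ∉ bs × b ∉ as × b ∉ bs → Pairing as bs →
        Pairing (a ∷ as) (b ∷ bs)

pairing : {as bs : List (Fin n)} → Unique as → Unique bs → (∀ {v} → v ∈ as → v ∉ bs) →
          length as ≡ length bs → Pairing as bs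
pairing {as = []}    {[]}    _           _           _    _  = []
pairing {as = a ∷ _} {b ∷ _} (a∉ ∷ as!) (b∉ ∷ bs!) disj len =
  ( (λ { (here a≡b) → disj (here refl) (here a≡b) ; (there a∈) → All¬⇒¬Any a∉ a∈ })
  , disj (here refl) ∘ there
  , (λ b∈as → disj (there b∈as) (here refl))
  , All¬⇒¬Any b∉ )
  ∷ pairing as! bs! (λ v∈ v∈′ → disj (there v∈) (there v∈′)) (ℕ.suc-injective len)

∈⇒≢ : {u v : Fin n} {xs : List (Fin n)} → u ∈ xs → v ∉ xs → u ≢ v
∈⇒≢ u∈ v∉ refl = v∉ u∈

swapPairs-fix : {as bs : List (Fin n)} {v : Fin n} → Pairing as bs → v ∉ as → v ∉ bs →
                swapPairs as bs v ≡ v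
swapPairs-fix []       _   _    = refl
swapPairs-fix (_ ∷ ps) v∉ v∉′ =
  trans (cong (PC.transpose _ _) (swapPairs-fix ps (v∉ ∘ there) (v∉′ ∘ there)))
        (transpose-fix (v∉ ∘ here) (v∉′ ∘ here))

swapPairs-involutive : {as bs : List (Fin n)} → Pairing as bs →
                       ∀ v → swapPairs as bs (swapPairs as bs v) ≡ v
swapPairs-involutive []                              v = refl
swapPairs-involutive {as = a ∷ as} {b ∷ bs} ((a∉ , a∉bs , b∉as , b∉bs) ∷ ps) v = begin
  τ (s (τ (s v)))  ≡⟨ cong τ (transpose-commute s sa≡a sb≡b s-injective (s v)) ⟩
  τ (τ (s (s v)))  ≡⟨ transpose-involutive (s (s v)) ⟩
  s (s v)          ≡⟨ swapPairs-involutive ps v ⟩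
  v                ∎
  where
  open ≡-Reasoning
  τ = PC.transpose a b
  s = swapPairs as bs
  sa≡a : s a ≡ a
  sa≡a = swapPairs-fix ps (a∉ ∘ there) a∉bs
  sb≡b : s b ≡ b
  sb≡b = swapPairs-fix ps b∉as b∉bs
  s-injective : ∀ {x y} → s x ≡ s y → x ≡ y
  s-injective {x} {y} sx≡sy =
    trans (sym (swapPairs-involutive ps x)) (trans (cong s sx≡sy) (swapPairs-involutive ps y))

swapPairs-∈ˡ : {as bs : List (Fin n)} {v : Fin n} → Pairing as bs → v ∈ as → swapPairs as bs v ∈ bs
swapPairs-∈ˡ {as = a ∷ _} {b ∷ _} ((a∉ , a∉bs , _ , _) ∷ ps) (here refl) =
  here (trans (cong (PC.transpose a b) (swapPairs-fix ps (a∉ ∘ there) a∉bs))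
              (transpose-at-i {i = a} {j = b}))
swapPairs-∈ˡ ((_ , a∉bs , _ , b∉bs) ∷ ps) (there v∈) =
  there (subst (_∈ _) (sym (transpose-fix (∈⇒≢ sv∈ a∉bs) (∈⇒≢ sv∈ b∉bs))) sv∈)
  where sv∈ = swapPairs-∈ˡ ps v∈

swapPairs-∈ʳ : {as bs : List (Fin n)} {v : Fin n} → Pairing as bs → v ∈ bs → swapPairs as bs v ∈ as
swapPairs-∈ʳ {as = a ∷ _} {b ∷ _} ((_ , _ , b∉as , b∉bs) ∷ ps) (here refl) =
  here (trans (cong (PC.transpose a b) (swapPairs-fix ps b∉as b∉bs))
              (transpose-at-j {i = a} {j = b}))
swapPairs-∈ʳ ((a∉ , _ , b∉as , _) ∷ ps) (there v∈) =
  there (subst (_∈ _) (sym (transpose-fix (∈⇒≢ sv∈ (a∉ ∘ there)) (∈⇒≢ sv∈ b∉as))) sv∈)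
  where sv∈ = swapPairs-∈ʳ ps v∈

record IsEquivalenceᵇ (B : Fin n → Fin n → Bool) : Set where
  field
    reflexive  : ∀ z → B z z ≡ true
    symmetric  : ∀ {z u} → B z u ≡ true → B u z ≡ true
    transitive : ∀ {z u w} → B z u ≡ true → B u w ≡ true → B z w ≡ true

  block : ∀ {z u} → B z u ≡ true → ∀ w → B u w ≡ B z w
  block zu w = Bool.⇔→≡ (mk⇔ (transitive zu) (transitive (symmetric zu)))

  commutative : ∀ u w → B u w ≡ B w u
  commutative u w = Bool.⇔→≡ (mk⇔ symmetric symmetric)

module BlockSwap {B : Fin n → Fin n → Bool} (isEquivalence : IsEquivalenceᵇ B)
                 {a b : Fin n} (a≁b : B a b ≡ false) (sameSize : countFin (B a) ≡ countFin (B b))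
                 where
  open IsEquivalenceᵇ isEquivalence

  private
    ≁b : ∀ {v} → B a v ≡ true → B b v ≡ false
    ≁b {v} av with B b v in bv
    ... | false = refl
    ... | true  = ⊥-elim (true≢false (trans (sym (transitive av (symmetric bv))) a≁b))

    ≁a : ∀ {v} → B b v ≡ true → B a v ≡ false
    ≁a {v} bv with B a v in av
    ... | false = refl
    ... | true  = ⊥-elim (true≢false (trans (sym bv) (≁b av)))

    pairs : Pairing (enumerate (B a)) (enumerate (B b))
    pairs = pairing (enumerate-unique (B a)) (enumerate-unique (B b))
      (λ v∈a v∈b → true≢false (trans (sym (∈-enumerate⁻ v∈b)) (≁b (∈-enumerate⁻ v∈a))))
      (trans (length-enumerate (B a)) (trans sameSize (sym (length-enumerate (B b)))))

    s : Fin n → Fin n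
    s = swapPairs (enumerate (B a)) (enumerate (B b))

    s-a→b : ∀ {v} → B a v ≡ true → B b (s v) ≡ true
    s-a→b av = ∈-enumerate⁻ (swapPairs-∈ˡ pairs (∈-enumerate⁺ av))

    s-b→a : ∀ {v} → B b v ≡ true → B a (s v) ≡ true
    s-b→a bv = ∈-enumerate⁻ (swapPairs-∈ʳ pairs (∈-enumerate⁺ bv))

    s-fix : ∀ {v} → B a v ≡ false → B b v ≡ false → s v ≡ v
    s-fix av bv = swapPairs-fix pairs (λ v∈ → true≢false (trans (sym (∈-enumerate⁻ v∈)) av))
                                      (λ v∈ → true≢false (trans (sym (∈-enumerate⁻ v∈)) bv))

    B-b∘s : ∀ w → B b (s w) ≡ B a w
    B-b∘s w with B a w in aw | B b w in bw
    ... | true  | _     = s-a→b aw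
    ... | false | true  = ≁b (s-b→a bw)
    ... | false | false = trans (cong (B b) (s-fix aw bw)) bw

    B-a∘s : ∀ w → B a (s w) ≡ B b w
    B-a∘s w with B b w in bw | B a w in aw
    ... | true  | _     = s-b→a bw
    ... | false | true  = ≁a (s-a→b aw)
    ... | false | false = trans (cong (B a) (s-fix aw bw)) aw

    preserves-from-block : ∀ {u} → B a u ≡ true ⊎ B b u ≡ true → ∀ w → B (s u) (s w) ≡ B u w
    preserves-from-block (inj₁ au) w =
      trans (block (s-a→b au) (s w)) (trans (B-b∘s w) (sym (block au w)))
    preserves-from-block (inj₂ bu) w =
      trans (block (s-b→a bu) (s w)) (trans (B-a∘s w) (sym (block bu w)))

  σ : Permutation′ n
  σ = permutation s s (swapPairs-involutive pairs) (swapPairs-involutive pairs)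

  σ-preserves : ∀ u w → B (σ ⟨$⟩ʳ u) (σ ⟨$⟩ʳ w) ≡ B u w
  σ-preserves u w with B a u in au | B b u in bu | B a w in aw | B b w in bw
  ... | true  | _     | _     | _     = preserves-from-block (inj₁ au) w
  ... | false | true  | _     | _     = preserves-from-block (inj₂ bu) w
  ... | false | false | true  | _     = trans (commutative (s u) (s w))
                                        (trans (preserves-from-block (inj₁ aw) u) (commutative w u))
  ... | false | false | false | true  = trans (commutative (s u) (s w))
                                        (trans (preserves-from-block (inj₂ bw) u) (commutative w u))
  ... | false | false | false | false = cong₂ B (s-fix au bu) (s-fix aw bw)

  σ-moves : B a (σ ⟨$⟩ʳ a) ≡ false
  σ-moves = ≁a (s-a→b (reflexive a))

adj⇒≢ : (Γ : Graph n) {z u : Fin n} → adj Γ z u ≡ true → u ≢ z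
adj⇒≢ Γ {z} zu refl = true≢false (trans (sym zu) (irrefl Γ z))

Fixes : Fin n → Permutation′ n → Set
Fixes ω g = g ⟨$⟩ʳ ω ≡ ω

module _ (Γ : Graph n) where

  isAut-id : IsAut Γ Perm.id
  isAut-id x y = refl

  isAut-flip : ∀ {g} → IsAut Γ g → IsAut Γ (flip g)
  isAut-flip {g} g-aut x y =
    trans (sym (g-aut (g ⟨$⟩ˡ x) (g ⟨$⟩ˡ y))) (cong₂ (adj Γ) (inverseʳ g) (inverseʳ g))

  isAut-∘ : ∀ {g h} → IsAut Γ g → IsAut Γ h → IsAut Γ (g ∘ₚ h)
  isAut-∘ {g} g-aut h-aut x y = trans (h-aut (g ⟨$⟩ʳ x) (g ⟨$⟩ʳ y)) (g-aut x y)

  isAut-blockPreserving : (B : Fin n → Fin n → Bool) (φ : Bool → Bool → Bool) →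
                          (∀ u w → adj Γ u w ≡ φ (eqB u w) (B u w)) →
                          (σ : Permutation′ n) → (∀ u w → B (σ ⟨$⟩ʳ u) (σ ⟨$⟩ʳ w) ≡ B u w) →
                          IsAut Γ σ
  isAut-blockPreserving B φ adj≡φ σ σ-preserves u w = begin
    adj Γ (σ ⟨$⟩ʳ u) (σ ⟨$⟩ʳ w)                              ≡⟨ adj≡φ _ _ ⟩
    φ (eqB (σ ⟨$⟩ʳ u) (σ ⟨$⟩ʳ w)) (B (σ ⟨$⟩ʳ u) (σ ⟨$⟩ʳ w))  ≡⟨ cong₂ φ (eqB-⟨$⟩ʳ σ u w)
                                                                      (σ-preserves u w) ⟩
    φ (eqB u w) (B u w)                                       ≡⟨ adj≡φ u w ⟨
    adj Γ u w                                                 ∎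
    where open ≡-Reasoning

  module _ {P : Permutation′ n → Set} where

    sameOrbit-refl : P Perm.id → ∀ x → SameOrbit Γ P x x
    sameOrbit-refl P-id x = Perm.id , isAut-id , P-id , refl

    sameOrbit-sym : (∀ {g} → P g → P (flip g)) → ∀ {x y} → SameOrbit Γ P x y → SameOrbit Γ P y x
    sameOrbit-sym P-flip (g , g-aut , Pg , refl) =
      flip g , isAut-flip {g} g-aut , P-flip Pg , inverseˡ g

    sameOrbit-trans : (∀ {g h} → P g → P h → P (g ∘ₚ h)) →
                      ∀ {x y z} → SameOrbit Γ P x y → SameOrbit Γ P y z → SameOrbit Γ P x z
    sameOrbit-trans P-∘ (g , g-aut , Pg , refl) (h , h-aut , Ph , refl) =
      g ∘ₚ h , isAut-∘ {g} {h} g-aut h-aut , P-∘ Pg Ph , refl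

  Orbit : Fin n → Fin n → Set
  Orbit = SameOrbit Γ (λ _ → ⊤)

  orbit-refl : ∀ x → Orbit x x
  orbit-refl = sameOrbit-refl tt

  orbit-sym : ∀ {x y} → Orbit x y → Orbit y x
  orbit-sym = sameOrbit-sym (λ _ → tt)

  orbit-trans : ∀ {x y z} → Orbit x y → Orbit y z → Orbit x z
  orbit-trans = sameOrbit-trans (λ _ _ → tt)

  orbit-via : (g : Permutation′ n) → IsAut Γ g → ∀ x → Orbit x (g ⟨$⟩ʳ x)
  orbit-via g g-aut x = g , g-aut , tt , refl

  StabOrbit : Fin n → Fin n → Fin n → Set
  StabOrbit ω = SameOrbit Γ (Fixes ω)

  stabOrbit-sym : ∀ {ω x y} → StabOrbit ω x y → StabOrbit ω y x
  stabOrbit-sym {ω} = sameOrbit-sym {P = Fixes ω}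
    λ {g} gω≡ω → trans (cong (g ⟨$⟩ˡ_) (sym gω≡ω)) (inverseˡ g)

  stabOrbit-trans : ∀ {ω x y z} → StabOrbit ω x y → StabOrbit ω y z → StabOrbit ω x z
  stabOrbit-trans {ω} = sameOrbit-trans {P = Fixes ω}
    λ {g} {h} gω≡ω hω≡ω → trans (cong (h ⟨$⟩ʳ_) gω≡ω) hω≡ω

  stabOrbit⇒orbit : ∀ {ω x y} → StabOrbit ω x y → Orbit x y
  stabOrbit⇒orbit (g , g-aut , _ , gx≡y) = g , g-aut , tt , gx≡y

any?-→ : ∀ {m} {P : (Fin m → Fin n) → Set} → Decidable P → P Respects _≗_ → Dec (∃ P)
any?-→ {m = zero}  P? P-resp = map′ (λ p → _ , p) (λ (f , p) → P-resp (λ ()) p) (P? (λ ()))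
any?-→ {m = suc m} P? P-resp =
  map′ (λ (a , f , p) → a Vector.∷ f , p)
       (λ (f , p) → Vector.head f , Vector.tail f
                  , P-resp (λ { F.zero → refl ; (F.suc i) → refl }) p)
       (F.any? λ a → any?-→ (P? ∘ (a Vector.∷_))
                           (λ f≗g → P-resp (λ { F.zero → refl ; (F.suc i) → f≗g i })))

module _ (Γ : Graph n) where

  private
    HasInverse : (Fin n → Fin n) → Set
    HasInverse f = ∃ λ (h : Fin n → Fin n) → (∀ i → f (h i) ≡ i) × (∀ i → h (f i) ≡ i)

    PreservesAdj : (Fin n → Fin n) → Set
    PreservesAdj f = ∀ x y → adj Γ (f x) (f y) ≡ adj Γ x y

    hasInverse? : Decidable HasInverse
    hasInverse? f = any?-→ (λ h → F.all? (λ i → f (h i) ≟ i) ×-dec F.all? (λ i → h (f i) ≟ i))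
      (λ h≗h′ (fh , hf) → (λ i → trans (cong f (sym (h≗h′ i))) (fh i))
                        , (λ i → trans (sym (h≗h′ (f i))) (hf i)))

    preservesAdj? : Decidable PreservesAdj
    preservesAdj? f = F.all? λ x → F.all? λ y → adj Γ (f x) (f y) Bool.≟ adj Γ x y

  any?-isAut : {Q : (Fin n → Fin n) → Set} → Decidable Q → Q Respects _≗_ →
               Dec (∃ λ g → IsAut Γ g × Q (g ⟨$⟩ʳ_))
  any?-isAut {Q} Q? Q-resp =
    map′ (λ (f , (h , fh , hf) , f-aut , q) → permutation f h fh hf , f-aut , q)
         (λ (g , g-aut , q) →
            (g ⟨$⟩ʳ_) , ((g ⟨$⟩ˡ_) , (λ _ → inverseʳ g) , (λ _ → inverseˡ g)) , g-aut , q)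
         (any?-→ (λ f → hasInverse? f ×-dec preservesAdj? f ×-dec Q? f) candidate-resp)
    where
    candidate-resp : (λ f → HasInverse f × PreservesAdj f × Q f) Respects _≗_
    candidate-resp f≗f′ ((h , fh , hf) , f-aut , q) =
        (h , (λ i → trans (sym (f≗f′ (h i))) (fh i)) , (λ i → trans (cong h (sym (f≗f′ i))) (hf i)))
      , (λ x y → trans (cong₂ (adj Γ) (sym (f≗f′ x)) (sym (f≗f′ y))) (f-aut x y))
      , Q-resp f≗f′ q

-- Diagonal matrices and T_{0,ω}

diag : (Fin n → ℚ) → Mat n
diag d i j = if eqB i j then d i else 0ℚ

module _ (d : Fin n → ℚ) where

  diag-on : ∀ i → diag d i i ≡ d i
  diag-on i rewrite eqB-refl i = refl

  diag-off : ∀ {i j} → i ≢ j → diag d i j ≡ 0ℚ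
  diag-off i≢j rewrite eqB-≢ i≢j = refl

sumFin-zero : (f : Fin n → ℚ) → (∀ l → f l ≡ 0ℚ) → sumFin f ≡ 0ℚ
sumFin-zero {zero}  f f≡0 = refl
sumFin-zero {suc n} f f≡0 rewrite f≡0 F.zero | sumFin-zero (f ∘ F.suc) (f≡0 ∘ F.suc) = refl

sumFin-delta : (f : Fin n → ℚ) (j : Fin n) → (∀ l → l ≢ j → f l ≡ 0ℚ) → sumFin f ≡ f j
sumFin-delta f F.zero f≡0 rewrite sumFin-zero (f ∘ F.suc) (λ l → f≡0 (F.suc l) λ ()) =
  ℚ.+-identityʳ (f F.zero)
sumFin-delta f (F.suc j) f≡0 rewrite f≡0 F.zero λ () =
  trans (ℚ.+-identityˡ _)
        (sumFin-delta (f ∘ F.suc) j (λ l l≢j → f≡0 (F.suc l) (l≢j ∘ F.suc-injective)))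

diag-*ᴹ : (d : Fin n → ℚ) (M : Mat n) → ∀ i j → (diag d *ᴹ M) i j ≡ d i ℚ.* M i j
diag-*ᴹ d M i j =
  trans (sumFin-delta _ i λ l l≢i →
           trans (cong (ℚ._* M l j) (diag-off d (l≢i ∘ sym))) (ℚ.*-zeroˡ (M l j)))
        (cong (ℚ._* M i j) (diag-on d i))

*ᴹ-diag : (M : Mat n) (d : Fin n → ℚ) → ∀ i j → (M *ᴹ diag d) i j ≡ M i j ℚ.* d j
*ᴹ-diag M d i j =
  trans (sumFin-delta _ j λ l l≢j →
           trans (cong (M i l ℚ.*_) (diag-off d l≢j)) (ℚ.*-zeroʳ (M i l)))
        (cong (M i j ℚ.*_) (diag-on d j))

permMat-*ᴹ-diag : (g : Permutation′ n) (d : Fin n → ℚ) → (∀ j → d (g ⟨$⟩ʳ j) ≡ d j) →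
                  (permMat g *ᴹ diag d) ≈ᴹ (diag d *ᴹ permMat g)
permMat-*ᴹ-diag g d d∘g≗d i j =
  trans (*ᴹ-diag (permMat g) d i j) (trans (entry (i ≟ g ⟨$⟩ʳ j)) (sym (diag-*ᴹ d (permMat g) i j)))
  where
  entry : Dec (i ≡ g ⟨$⟩ʳ j) → permMat g i j ℚ.* d j ≡ d i ℚ.* permMat g i j
  entry (yes refl) rewrite eqB-refl (g ⟨$⟩ʳ j) | d∘g≗d j = ℚ.*-comm 1ℚ (d j)
  entry (no i≢gj)  rewrite eqB-≢ i≢gj = trans (ℚ.*-zeroˡ (d j)) (sym (ℚ.*-zeroʳ (d i)))

lincomb-diag : {I : Set} (M : I → Mat n) {x y : Fin n} → (∀ t → M t x x ≡ M t y y) →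
               ∀ cs → lincomb M cs x x ≡ lincomb M cs y y
lincomb-diag M Mxx≡Myy []             = refl
lincomb-diag M Mxx≡Myy ((c , t) ∷ cs) =
  cong₂ ℚ._+_ (cong (c ℚ.*_) (Mxx≡Myy t)) (lincomb-diag M Mxx≡Myy cs)

module _ (Γ : Graph n) (ω : Fin n) where

  T0-generator-diag : ∀ i j k x → ((Estar Γ ω i *ᴹ A Γ j) *ᴹ Estar Γ ω k) x x
                                  ≡ (A Γ i ω x ℚ.* A Γ j x x) ℚ.* A Γ k ω x
  T0-generator-diag i j k x =
    trans (*ᴹ-diag (Estar Γ ω i *ᴹ A Γ j) (A Γ k ω) x x)
          (cong (ℚ._* A Γ k ω x) (diag-*ᴹ (A Γ i ω) (A Γ j) x x))

  relA-diag : ∀ j x y → relA Γ j x x ≡ relA Γ j y y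
  relA-diag F.zero                   x y rewrite eqB-refl x | eqB-refl y = refl
  relA-diag (F.suc F.zero)           x y = trans (irrefl Γ x) (sym (irrefl Γ y))
  relA-diag (F.suc (F.suc F.zero))   x y rewrite eqB-refl x | eqB-refl y = refl

  T0-diag-cong : ∀ {M x y} → InT0 Γ ω M → (∀ i → relA Γ i ω x ≡ relA Γ i ω y) → M x x ≡ M y y
  T0-diag-cong {M} {x} {y} (cs , M≈) same = begin
    M x x             ≡⟨ M≈ x x ⟩
    lincomb _ cs x x  ≡⟨ lincomb-diag _ (λ (i , j , k) → generator-diag i j k) cs ⟩
    lincomb _ cs y y  ≡⟨ M≈ y y ⟨
    M y y             ∎
    where
    open ≡-Reasoning
    generator-diag : ∀ i j k → ((Estar Γ ω i *ᴹ A Γ j) *ᴹ Estar Γ ω k) x x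
                              ≡ ((Estar Γ ω i *ᴹ A Γ j) *ᴹ Estar Γ ω k) y y
    generator-diag i j k = begin
      _
        ≡⟨ T0-generator-diag i j k x ⟩
      (A Γ i ω x ℚ.* A Γ j x x) ℚ.* A Γ k ω x
        ≡⟨ cong₂ ℚ._*_ (cong₂ ℚ._*_ (cong b2q (same i)) (cong b2q (relA-diag j x y)))
                       (cong b2q (same k)) ⟩
      (A Γ i ω y ℚ.* A Γ j y y) ℚ.* A Γ k ω y
        ≡⟨ T0-generator-diag i j k y ⟨
      _ ∎

  relA-sameSubconstituent : ∀ {x y} → x ≢ ω → y ≢ ω → adj Γ ω x ≡ adj Γ ω y →
                            ∀ i → relA Γ i ω x ≡ relA Γ i ω y
  relA-sameSubconstituent x≢ω y≢ω ωx≡ωy F.zero =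
    trans (eqB-≢ (x≢ω ∘ sym)) (sym (eqB-≢ (y≢ω ∘ sym)))
  relA-sameSubconstituent x≢ω y≢ω ωx≡ωy (F.suc F.zero) = ωx≡ωy
  relA-sameSubconstituent x≢ω y≢ω ωx≡ωy (F.suc (F.suc F.zero))
    rewrite eqB-≢ (x≢ω ∘ sym) | eqB-≢ (y≢ω ∘ sym) | ωx≡ωy = refl

-- The G_ω-orbits are the subconstituents

b2q-does⇒ : {P : Set} (P? : Dec P) → b2q (does P?) ≡ 1ℚ → P
b2q-does⇒ (yes p) _ = p
b2q-does⇒ (no _)  ()

-- The converse holds for every automorphism fixing ω.
SubconstituentsAreOrbits : Graph n → Fin n → Set
SubconstituentsAreOrbits Γ ω =
  ∀ {x y} → x ≢ ω → y ≢ ω → adj Γ ω x ≡ adj Γ ω y → StabOrbit Γ ω x y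

module _ (Γ : Graph n) (ω : Fin n) where

  -- Decided by exhaustive search over all maps Fin n → Fin n, so that the orbit indicator is a
  -- genuine 0/1 matrix.
  stabOrbit? : ∀ x y → Dec (StabOrbit Γ ω x y)
  stabOrbit? x y = any?-isAut Γ (λ f → (f ω ≟ ω) ×-dec (f x ≟ y))
    (λ f≗g (fω≡ω , fx≡y) → trans (sym (f≗g ω)) fω≡ω , trans (sym (f≗g x)) fx≡y)

  orbitIndicator : Fin n → Mat n
  orbitIndicator x = diag (λ y → b2q (does (stabOrbit? x y)))

  orbitIndicator∈T̃ : ∀ x → InTtilde Γ ω (orbitIndicator x)
  orbitIndicator∈T̃ x g (g-aut , gω≡ω) = permMat-*ᴹ-diag g _ λ j →
    cong b2q (does-⇔ (mk⇔ (λ x~gj → stabOrbit-trans Γ x~gj (stabOrbit-sym Γ (j~gj j)))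
                          (λ x~j → stabOrbit-trans Γ x~j (j~gj j)))
                     (stabOrbit? x (g ⟨$⟩ʳ j)) (stabOrbit? x j))
    where
    j~gj : ∀ j → StabOrbit Γ ω j (g ⟨$⟩ʳ j)
    j~gj j = g , g-aut , gω≡ω , refl

  subconstituentsAreOrbits : InT0 Γ ω ≐ InT Γ ω → InT Γ ω ≐ InTtilde Γ ω →
                             SubconstituentsAreOrbits Γ ω
  subconstituentsAreOrbits T0≐T T≐T̃ {x} {y} x≢ω y≢ω ωx≡ωy = b2q-does⇒ (stabOrbit? x y) (begin
    b2q (does (stabOrbit? x y))  ≡⟨ diag-on χ y ⟨
    orbitIndicator x y y         ≡⟨ T0-diag-cong Γ ω indicator∈T0
                                      (relA-sameSubconstituent Γ ω x≢ω y≢ω ωx≡ωy) ⟨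
    orbitIndicator x x x         ≡⟨ diag-on χ x ⟩
    b2q (does (stabOrbit? x x))  ≡⟨ cong b2q (dec-true (stabOrbit? x x) (sameOrbit-refl Γ refl x)) ⟩
    1ℚ                           ∎)
    where
    open ≡-Reasoning
    χ : Fin n → ℚ
    χ v = b2q (does (stabOrbit? x v))
    indicator∈T0 : InT0 Γ ω (orbitIndicator x)
    indicator∈T0 = proj₂ (T0≐T _) (proj₂ (T≐T̃ _) (orbitIndicator∈T̃ x))

module Subconstituents {Γ : Graph n} {ω : Fin n} (orbits : SubconstituentsAreOrbits Γ ω) where

  sameSubconstituent⇒orbit : ∀ {x y} → x ≢ ω → y ≢ ω → adj Γ ω x ≡ adj Γ ω y → Orbit Γ x y
  sameSubconstituent⇒orbit x≢ω y≢ω ωx≡ωy = stabOrbit⇒orbit Γ (orbits x≢ω y≢ω ωx≡ωy)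

  stabHas3Orbits : ∀ {b c} → adj Γ ω b ≡ true → c ≢ ω → adj Γ ω c ≡ false → StabHas3Orbits Γ ω
  stabHas3Orbits {b} {c} ωb c≢ω ωc = ω , b , c , onlyω (adj⇒≢ Γ ωb) , onlyω c≢ω , b≁c , cover
    where
    onlyω : ∀ {y} → y ≢ ω → ¬ StabOrbit Γ ω ω y
    onlyω y≢ω (h , _ , hω≡ω , hω≡y) = y≢ω (trans (sym hω≡y) hω≡ω)
    b≁c : ¬ StabOrbit Γ ω b c
    b≁c (h , h-aut , hω≡ω , hb≡c) =
      true≢false (trans (sym ωb) (trans (sym (h-aut ω b)) (trans (cong₂ (adj Γ) hω≡ω hb≡c) ωc)))
    cover : ∀ y → StabOrbit Γ ω ω y ⊎ StabOrbit Γ ω b y ⊎ StabOrbit Γ ω c y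
    cover y with y ≟ ω | adj Γ ω y in ωy
    ... | yes refl | _     = inj₁ (sameOrbit-refl Γ refl ω)
    ... | no y≢ω   | true  = inj₂ (inj₁ (orbits (adj⇒≢ Γ ωb) y≢ω (trans ωb (sym ωy))))
    ... | no y≢ω   | false = inj₂ (inj₂ (orbits c≢ω y≢ω (trans ωc (sym ωy))))

-- Strongly regular graphs with μ = 0 or μ = k

closedNbhd : Graph n → Fin n → Fin n → Bool
closedNbhd Γ z v = eqB z v ∨ adj Γ z v

IsUnionOfCliques : Graph n → Set
IsUnionOfCliques Γ = ∀ {a b v} → a ≢ b → adj Γ a v ≡ true → adj Γ b v ≡ true → adj Γ a b ≡ true

IsCompleteMultipartite : Graph n → Set
IsCompleteMultipartite Γ = ∀ {a b} → a ≢ b → adj Γ a b ≡ false → ∀ v → adj Γ a v ≡ adj Γ b v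

module _ (Γ : Graph n) where

  closedNbhd-intro : ∀ {z u} → z ≡ u ⊎ adj Γ z u ≡ true → closedNbhd Γ z u ≡ true
  closedNbhd-intro {z} (inj₁ refl) = cong (_∨ adj Γ z z) (eqB-refl z)
  closedNbhd-intro {z} {u} (inj₂ zu) = trans (cong (eqB z u ∨_) zu) (Bool.∨-zeroʳ (eqB z u))

  closedNbhd-elim : ∀ {z u} → closedNbhd Γ z u ≡ true → z ≡ u ⊎ adj Γ z u ≡ true
  closedNbhd-elim {z} {u} e = Sum.map₁ eqB⇒≡ (∨-≡-true (eqB z u) e)

  closedNbhd-false : ∀ {z u} → closedNbhd Γ z u ≡ false → u ≢ z × adj Γ z u ≡ false
  closedNbhd-false {z} {u} e =
      (λ { refl → true≢false (trans (sym (eqB-refl z)) (Bool.∨-conicalˡ _ _ e)) })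
    , Bool.∨-conicalʳ _ _ e

  adj-via-closedNbhd : ∀ u w → adj Γ u w ≡ not (eqB u w) ∧ closedNbhd Γ u w
  adj-via-closedNbhd u w with u ≟ w
  ... | yes refl = irrefl Γ u
  ... | no _     = refl

  closedNbhd-isEquivalence : IsUnionOfCliques Γ → IsEquivalenceᵇ (closedNbhd Γ)
  closedNbhd-isEquivalence cliques = record
    { reflexive  = λ z → closedNbhd-intro (inj₁ refl)
    ; symmetric  = λ zu →
        closedNbhd-intro (Sum.map sym (trans (Graph.sym Γ _ _)) (closedNbhd-elim zu))
    ; transitive = λ zu uw → transitive (closedNbhd-elim zu) (closedNbhd-elim uw)
    }
    where
    transitive : ∀ {z u w} → z ≡ u ⊎ adj Γ z u ≡ true → u ≡ w ⊎ adj Γ u w ≡ true →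
                 closedNbhd Γ z w ≡ true
    transitive (inj₁ refl) uw          = closedNbhd-intro uw
    transitive zu          (inj₁ refl) = closedNbhd-intro zu
    transitive {z} {u} {w} (inj₂ zu) (inj₂ uw) with z ≟ w
    ... | yes _   = refl
    ... | no z≢w  = cliques z≢w zu (trans (Graph.sym Γ w u) uw)

  nonAdj-isEquivalence : IsCompleteMultipartite Γ → IsEquivalenceᵇ (λ z w → not (adj Γ z w))
  nonAdj-isEquivalence multipartite = record
    { reflexive  = λ z → cong not (irrefl Γ z)
    ; symmetric  = λ {z} {u} zu → trans (cong not (Graph.sym Γ u z)) zu
    ; transitive = transitive
    }
    where
    transitive : ∀ {z u w} → not (adj Γ z u) ≡ true → not (adj Γ u w) ≡ true →
                 not (adj Γ z w) ≡ true
    transitive {z} {u} {w} zu uw with z ≟ u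
    ... | yes refl = uw
    ... | no z≢u   = trans (cong not (multipartite z≢u (Bool.not-injective zu) w)) uw

module StronglyRegular {Γ : Graph n} {k lam mu : ℕ} (srg : IsSRG Γ k lam mu) where
  open IsSRG srg

  countFin-closedNbhd : ∀ z → countFin (closedNbhd Γ z) ≡ suc k
  countFin-closedNbhd z = trans (countFin-insert z (adj Γ z) (irrefl Γ z)) (cong suc (regular z))

  countFin-nonAdj : ∀ z → k + countFin (λ w → not (adj Γ z w)) ≡ n
  countFin-nonAdj z = trans (cong (_+ _) (sym (regular z))) (countFin-complement (adj Γ z))

  neighbour : ∀ ω → ∃ λ b → adj Γ ω b ≡ true
  neighbour ω = countFin-witness (adj Γ ω) (subst (0 <_) (sym (regular ω)) nontrivial₁)

  nonNeighbour : ∀ ω → ∃ λ c → c ≢ ω × adj Γ ω c ≡ false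
  nonNeighbour ω with F.any? (λ c → ¬? (c ≟ ω) ×-dec (adj Γ ω c Bool.≟ false))
  ... | yes c = c
  ... | no ∄c = ⊥-elim (ℕ.<-irrefl (cong (_∸ 1) suc-k≡n) nontrivial₂)
    where
    selfOrNbr : ∀ v → ω ≡ v ⊎ adj Γ ω v ≡ true
    selfOrNbr v with v ≟ ω | adj Γ ω v in ωv
    ... | yes v≡ω | _     = inj₁ (sym v≡ω)
    ... | no _    | true  = inj₂ refl
    ... | no v≢ω  | false = ⊥-elim (∄c (v , v≢ω , ωv))
    suc-k≡n : suc k ≡ n
    suc-k≡n = trans (sym (countFin-closedNbhd ω))
                    (trans (countFin-cong (closedNbhd-intro Γ ∘ selfOrNbr)) countFin-all)

  private
    CommonNbr : Fin n → Fin n → Fin n → Bool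
    CommonNbr a b v = if adj Γ a v then adj Γ b v else false

    common-intro : ∀ {a b v} → adj Γ a v ≡ true → adj Γ b v ≡ true → CommonNbr a b v ≡ true
    common-intro {a} {b} {v} av bv = trans (cong (λ t → if t then adj Γ b v else false) av) bv

    common⊆adj : ∀ a b → CommonNbr a b ⊆ᵇ adj Γ a
    common⊆adj a b v _ with adj Γ a v
    common⊆adj a b v _  | true  = refl
    common⊆adj a b v () | false

    common⇒adj : ∀ {a b v} → CommonNbr a b v ≡ true → adj Γ b v ≡ true
    common⇒adj {a} {b} {v} e with adj Γ a v
    ... | true = e

  noCommonNbr⇒unionOfCliques : ∀ {ω c} → c ≢ ω → adj Γ ω c ≡ false →
                               (∀ {z} → adj Γ ω z ≡ true → adj Γ c z ≡ false) → IsUnionOfCliques Γ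
  noCommonNbr⇒unionOfCliques {ω} {c} c≢ω ωc noCommon {a} {b} {v} a≢b av bv with adj Γ a b in ab
  ... | true  = refl
  ... | false = ⊥-elim (ℕ.<-irrefl (sym μ≡0) (countFin-pos v (common-intro av bv)))
    where
    none : ∀ z → CommonNbr ω c z ≡ false
    none z with adj Γ ω z in ωz
    ... | true  = noCommon ωz
    ... | false = refl
    μ≡0 : common Γ a b ≡ 0
    μ≡0 = trans (nonadjacent a b a≢b ab)
                (trans (sym (nonadjacent ω c (c≢ω ∘ sym) ωc)) (countFin-none none))

  allCommonNbrs⇒completeMultipartite : ∀ {ω c} → c ≢ ω → adj Γ ω c ≡ false →
                                       (∀ {z} → adj Γ ω z ≡ true → adj Γ c z ≡ true) →
                                       IsCompleteMultipartite Γ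
  allCommonNbrs⇒completeMultipartite {ω} {c} c≢ω ωc allCommon {a} {b} a≢b ab v =
    Bool.⇔→≡ (mk⇔ (nbrs⊆ a≢b ab v) (nbrs⊆ (a≢b ∘ sym) (trans (Graph.sym Γ b a) ab) v))
    where
    all : ∀ z → CommonNbr ω c z ≡ adj Γ ω z
    all z with adj Γ ω z in ωz
    ... | true  = allCommon ωz
    ... | false = refl
    μ≡k : mu ≡ k
    μ≡k = trans (sym (nonadjacent ω c (c≢ω ∘ sym) ωc)) (trans (countFin-cong all) (regular ω))
    nbrs⊆ : ∀ {a b} → a ≢ b → adj Γ a b ≡ false → ∀ v → adj Γ a v ≡ true → adj Γ b v ≡ true
    nbrs⊆ {a} {b} a≢b ab v av = common⇒adj (countFin-⊆-≡ (common⊆adj a b)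
      (trans (nonadjacent a b a≢b ab) (trans μ≡k (sym (regular a)))) v av)

  unionOfCliques⇒moveToNonNbr : IsUnionOfCliques Γ → ∀ {ω c} → c ≢ ω → adj Γ ω c ≡ false →
    ∃ λ g → IsAut Γ g × g ⟨$⟩ʳ ω ≢ ω × adj Γ ω (g ⟨$⟩ʳ ω) ≡ false
  unionOfCliques⇒moveToNonNbr cliques {ω} {c} c≢ω ωc =
    σ , isAut-blockPreserving Γ (closedNbhd Γ) (λ e b → not e ∧ b) (adj-via-closedNbhd Γ)
                              σ σ-preserves
      , closedNbhd-false Γ σ-moves
    where
    ω≁c : closedNbhd Γ ω c ≡ false
    ω≁c rewrite eqB-≢ (c≢ω ∘ sym) = ωc
    open BlockSwap (closedNbhd-isEquivalence Γ cliques) ω≁c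
                   (trans (countFin-closedNbhd ω) (sym (countFin-closedNbhd c)))

  completeMultipartite⇒moveToNbr : IsCompleteMultipartite Γ → ∀ {ω b} → adj Γ ω b ≡ true →
    ∃ λ g → IsAut Γ g × adj Γ ω (g ⟨$⟩ʳ ω) ≡ true
  completeMultipartite⇒moveToNbr multipartite {ω} {b} ωb =
    σ , isAut-blockPreserving Γ _ (λ _ → not) (λ u w → sym (Bool.not-involutive (adj Γ u w)))
                              σ σ-preserves
      , Bool.not-injective σ-moves
    where
    open BlockSwap (nonAdj-isEquivalence Γ multipartite) (cong not ωb)
                   (ℕ.+-cancelˡ-≡ k _ _ (trans (countFin-nonAdj ω) (sym (countFin-nonAdj b))))

-- Transitivity

module Transitivity {Γ : Graph n} {k lam mu : ℕ} (srg : IsSRG Γ k lam mu) {ω : Fin n}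
                    (orbits : SubconstituentsAreOrbits Γ ω) where
  open StronglyRegular srg
  open Subconstituents {Γ = Γ} {ω} orbits

  subconstituentsAreOrbitsAt : ∀ {z} → Orbit Γ ω z →
                               ∀ {u v} → u ≢ z → v ≢ z → adj Γ z u ≡ adj Γ z v → Orbit Γ u v
  subconstituentsAreOrbitsAt (f , f-aut , _ , refl) {u} {v} u≢fω v≢fω fωu≡fωv =
    orbit-trans Γ (orbit-sym Γ (fromPreimage u))
      (orbit-trans Γ (sameSubconstituent⇒orbit (preimage≢ω u≢fω) (preimage≢ω v≢fω) ωu′≡ωv′)
                     (fromPreimage v))
    where
    fromPreimage : ∀ w → Orbit Γ (f ⟨$⟩ˡ w) w
    fromPreimage w = f , f-aut , tt , inverseʳ f
    preimage≢ω : ∀ {w} → w ≢ f ⟨$⟩ʳ ω → f ⟨$⟩ˡ w ≢ ω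
    preimage≢ω w≢fω f⁻¹w≡ω = w≢fω (trans (sym (inverseʳ f)) (cong (f ⟨$⟩ʳ_) f⁻¹w≡ω))
    adj-preimage : ∀ w → adj Γ ω (f ⟨$⟩ˡ w) ≡ adj Γ (f ⟨$⟩ʳ ω) w
    adj-preimage w = trans (sym (f-aut ω (f ⟨$⟩ˡ w))) (cong (adj Γ (f ⟨$⟩ʳ ω)) (inverseʳ f))
    ωu′≡ωv′ : adj Γ ω (f ⟨$⟩ˡ u) ≡ adj Γ ω (f ⟨$⟩ˡ v)
    ωu′≡ωv′ = trans (adj-preimage u) (trans fωu≡fωv (sym (adj-preimage v)))

  orbit-total : ∀ {b c} → Orbit Γ ω b → adj Γ ω b ≡ true →
                Orbit Γ ω c → c ≢ ω → adj Γ ω c ≡ false → ∀ y → Orbit Γ ω y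
  orbit-total ω~b ωb ω~c c≢ω ωc y with y ≟ ω | adj Γ ω y in ωy
  ... | yes refl | _     = orbit-refl Γ ω
  ... | no y≢ω   | true  =
    orbit-trans Γ ω~b (sameSubconstituent⇒orbit (adj⇒≢ Γ ωb) y≢ω (trans ωb (sym ωy)))
  ... | no y≢ω   | false =
    orbit-trans Γ ω~c (sameSubconstituent⇒orbit c≢ω y≢ω (trans ωc (sym ωy)))

  orbit-meets-nonNbrs : ∀ {x} → Orbit Γ ω x → adj Γ ω x ≡ true →
                        ∃ λ c → Orbit Γ ω c × c ≢ ω × adj Γ ω c ≡ false
  orbit-meets-nonNbrs {x} ω~x ωx with nonNeighbour ω
  ... | c , c≢ω , ωc with F.any? (λ z → (adj Γ ω z Bool.≟ true) ×-dec (adj Γ c z Bool.≟ true))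
  ...   | yes (z , ωz , cz) =
    c , subconstituentsAreOrbitsAt ω~z (adj⇒≢ Γ ωz ∘ sym)
                                   (λ { refl → true≢false (trans (sym ωz) ωc) }) zω≡zc
      , c≢ω , ωc
    where
    zω≡zc : adj Γ z ω ≡ adj Γ z c
    zω≡zc = trans (Graph.sym Γ z ω) (trans ωz (sym (trans (Graph.sym Γ z c) cz)))
    ω~z : Orbit Γ ω z
    ω~z = orbit-trans Γ ω~x
            (sameSubconstituent⇒orbit (adj⇒≢ Γ ωx) (adj⇒≢ Γ ωz) (trans ωx (sym ωz)))
  ...   | no ∄common =
    let g , g-aut , gω≢ω , ωgω = unionOfCliques⇒moveToNonNbr
          (noCommonNbr⇒unionOfCliques c≢ω ωc noCommon) c≢ω ωc
    in g ⟨$⟩ʳ ω , orbit-via Γ g g-aut ω , gω≢ω , ωgω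
    where
    noCommon : ∀ {z} → adj Γ ω z ≡ true → adj Γ c z ≡ false
    noCommon {z} ωz with adj Γ c z in cz
    ... | false = refl
    ... | true  = ⊥-elim (∄common (z , ωz , cz))

  orbit-meets-nbrs : ∀ {x} → Orbit Γ ω x → x ≢ ω → adj Γ ω x ≡ false →
                     ∃ λ b → Orbit Γ ω b × adj Γ ω b ≡ true
  orbit-meets-nbrs {x} ω~x x≢ω ωx with nonNeighbour ω
  ... | c , c≢ω , ωc with F.any? (λ z → (adj Γ ω z Bool.≟ true) ×-dec (adj Γ c z Bool.≟ false))
  ...   | yes (z , ωz , cz) =
    z , subconstituentsAreOrbitsAt ω~c (c≢ω ∘ sym)
                                   (λ { refl → true≢false (trans (sym ωz) ωc) })
                                   (trans (Graph.sym Γ c ω) (trans ωc (sym cz)))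
      , ωz
    where
    ω~c : Orbit Γ ω c
    ω~c = orbit-trans Γ ω~x (sameSubconstituent⇒orbit x≢ω c≢ω (trans ωx (sym ωc)))
  ...   | no ∄nonCommon =
    let b , ωb = neighbour ω
        g , g-aut , ωgω = completeMultipartite⇒moveToNbr
          (allCommonNbrs⇒completeMultipartite c≢ω ωc allCommon) ωb
    in g ⟨$⟩ʳ ω , orbit-via Γ g g-aut ω , ωgω
    where
    allCommon : ∀ {z} → adj Γ ω z ≡ true → adj Γ c z ≡ true
    allCommon {z} ωz with adj Γ c z in cz
    ... | true  = refl
    ... | false = ⊥-elim (∄nonCommon (z , ωz , cz))

  transitive : ∀ g → IsAut Γ g → g ⟨$⟩ʳ ω ≢ ω → AutTransitive Γ
  transitive g g-aut gω≢ω x y = orbit-trans Γ (orbit-sym Γ (ω~ x)) (ω~ y)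
    where
    ω~gω = orbit-via Γ g g-aut ω
    ω~ : ∀ y → Orbit Γ ω y
    ω~ with adj Γ ω (g ⟨$⟩ʳ ω) in ωgω
    ... | true  = let c , ω~c , c≢ω , ωc = orbit-meets-nonNbrs ω~gω ωgω
                  in orbit-total ω~gω ωgω ω~c c≢ω ωc
    ... | false = let b , ω~b , ωb = orbit-meets-nbrs ω~gω gω≢ω ωgω
                  in orbit-total ω~b ωb ω~gω gω≢ω ωgω

  rank3 : ∀ g → IsAut Γ g → g ⟨$⟩ʳ ω ≢ ω → AutRank3 Γ
  rank3 g g-aut gω≢ω =
    let b , ωb = neighbour ω
        c , c≢ω , ωc = nonNeighbour ω
    in transitive g g-aut gω≢ω , ω , stabHas3Orbits ωb c≢ω ωc

theorem5p1 : ∀ {n : ℕ} (Γ : Graph n) (ω : Fin n)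
    → IsStronglyRegular Γ
    → InT0 Γ ω ≐ InT Γ ω
    → InT Γ ω ≐ InTtilde Γ ω
    → AutRank3 Γ
      ⊎ ( (∀ g → IsAut Γ g → g ⟨$⟩ʳ ω ≡ ω)
        × (∀ x y → x ≡ ω → y ≡ ω → SameOrbit Γ (λ _ → ⊤) x y)
        × (∀ x y → adj Γ ω x ≡ true → adj Γ ω y ≡ true → SameOrbit Γ (λ _ → ⊤) x y)
        × (∀ x y → x ≢ ω → y ≢ ω → adj Γ ω x ≡ false → adj Γ ω y ≡ false
             → SameOrbit Γ (λ _ → ⊤) x y) )
theorem5p1 Γ ω (k , lam , mu , srg) T0≐T T≐T̃
  with subconstituentsAreOrbits Γ ω T0≐T T≐T̃
     | any?-isAut Γ (λ f → ¬? (f ω ≟ ω)) (λ f≗g fω≢ω → fω≢ω ∘ trans (f≗g ω))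
... | orbits | yes (g , g-aut , gω≢ω) = inj₁ (Transitivity.rank3 srg orbits g g-aut gω≢ω)
... | orbits | no ∄moving =
  inj₂ ( (λ g g-aut → decidable-stable (g ⟨$⟩ʳ ω ≟ ω) (λ gω≢ω → ∄moving (g , g-aut , gω≢ω)))
       , (λ { x y refl refl → orbit-refl Γ ω })
       , (λ x y ωx ωy → sameSubconstituent⇒orbit (adj⇒≢ Γ ωx) (adj⇒≢ Γ ωy) (trans ωx (sym ωy)))
       , (λ x y x≢ω y≢ω ωx ωy → sameSubconstituent⇒orbit x≢ω y≢ω (trans ωx (sym ωy))) )
  where open Subconstituents {Γ = Γ} {ω} orbits
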